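{- For each integer $k\geq 0$, let $M_k=2^k+1$. Then there exists a set $D_k\subseteq \mathbb{N}$ such that $R_2(D_k,n)=R_2(\mathbb{N}\setminus D_k,n)$ for all integers $n\geq 2M_k-1$, $|D_k\cap A_0|=+\infty$, $|D_k\cap B_0|=+\infty$, and $$R_2(D_k,n)\leq \frac{n+1}{4(M_k-1)}$$ for infinitely many integers $n$.
   Context: $\mathbb{N}$ denotes the set of nonnegative integers (including $0$). For $A\subseteq\mathbb{N}$ and an integer $n$, $R_2(A,n)$ denotes the number of solutions of $n=a+a'$ with $a,a'\in A$ and $a<a'$. For $a\in\mathbb{N}$, $D(a)$ is the number of ones in the binary representation of $a$ (with $D(0)=0$). $A_0$ is the set of all $a\in\mathbb{N}$ with $D(a)$ even (the Thue–Morse set), and $B_0=\mathbb{N}\setminus A_0$. -}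

module Defs where

open import Data.Nat using (ℕ; zero; suc; _+_; _*_; _^_; _≤_; _<_; _%_; _/_)
open import Data.Bool using (Bool; true; false; if_then_else_; _∧_)
open import Data.Nat using (_<ᵇ_)
open import Relation.Binary.PropositionalEquality using (_≡_)

Subset : Set
Subset = ℕ → Bool

_∈_ : ℕ → Subset → Set
a ∈ S = S a ≡ true

complement : Subset → Subset
complement S a = if S a then false else true

onesFuel : ℕ → ℕ → ℕ
onesFuel zero    _ = 0
onesFuel (suc f) n = n % 2 + onesFuel f (n / 2)

-- D(a) : number of ones in the binary representation of a (fuel a suffices)
digitSum : ℕ → ℕ
digitSum a = onesFuel a a

isEvenᵇ : ℕ → Bool
isEvenᵇ m with m % 2
... | zero = true
... | suc _ = false

A₀ : Subset
A₀ a = isEvenᵇ (digitSum a)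

B₀ : Subset
B₀ = complement A₀

countR : Subset → ℕ → ℕ → ℕ
countR S n zero    = 0
countR S n (suc a) =
  (if (S a ∧ S (n Data.Nat.∸ a)) ∧ (a + a <ᵇ n) then 1 else 0) + countR S n a

R₂ : Subset → ℕ → ℕ
R₂ S n = countR S n (suc n)

M : ℕ → ℕ
M k = 2 ^ k + 1

{-# OPTIONS --safe #-}
module Submission where

-- Let p = 2^k, c = 2p, let Φ consist of 0 and of the numbers whose binary expansion begins
-- with that of c, and let D = A₀ △ Φ.  For any S, pairing off the decompositions n = a + b
-- with a < b gives R₂(S,n) − R₂(ℕ∖S,n) = |S ∩ [0,n]| − ⌈n/2⌉ − [n even and n/2 ∈ S].
-- A₀ contains exactly one of 2m, 2m+1, and Φ contains both or neither of them unless
-- m ∈ {0, p}, where the two defects cancel; hence |D ∩ [0,2N)| = N for N > p, and the right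
-- hand side vanishes for n ≥ 2p + 1.  For n = 2^j − 1 with j odd, n − a is the bitwise
-- complement of a, so exactly one of a, n − a lies in A₀; a pair can then lie inside D or
-- inside ℕ∖D only if it meets Φ, whence 2 R₂(D,n) ≤ |Φ ∩ [0,n]| = 2^j / c.

open import Defs
open import Data.Bool using (Bool; true; false; not; _∧_; _xor_; if_then_else_)
open import Data.Bool.Properties using (not-involutive; not-distribˡ-xor)
open import Data.Nat
open import Data.Nat.Divisibility using (m∣m*n)
open import Data.Nat.DivMod
open import Data.Nat.Properties
open import Data.Nat.Tactic.RingSolver using (solve-∀)
open import Data.Product using (Σ; _×_; _,_)
open import Function using (_∘_)
open import Relation.Binary using (tri<; tri≈; tri>)
open import Relation.Binary.PropositionalEquality
open import Relation.Nullary using (yes; no; contradiction)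
open import Relation.Nullary.Reflects using (ofʸ; ofⁿ)

data ParityView : ℕ → Set where
  even : ∀ m → ParityView (2 * m)
  odd  : ∀ m → ParityView (suc (2 * m))

parityView : ∀ n → ParityView n
parityView zero = even 0
parityView (suc n) with parityView n
... | even m = odd m
... | odd m  = subst ParityView (*-suc 2 m) (even (suc m))

2*m≡m+m : ∀ m → 2 * m ≡ m + m
2*m≡m+m = solve-∀

2*m/2≡m : ∀ m → 2 * m / 2 ≡ m
2*m/2≡m m = trans (cong (_/ 2) (*-comm 2 m)) (m*n/n≡m m 2)

[1+2*m]/2≡m : ∀ m → suc (2 * m) / 2 ≡ m
[1+2*m]/2≡m m = trans (+-distrib-/-∣ʳ 1 {d = 2} (m∣m*n m)) (2*m/2≡m m)

2*m%2≡0 : ∀ m → 2 * m % 2 ≡ 0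
2*m%2≡0 m = trans (cong (_% 2) (*-comm 2 m)) (m*n%n≡0 m 2)

[1+2*m]%2≡1 : ∀ m → suc (2 * m) % 2 ≡ 1
[1+2*m]%2≡1 m = trans (cong (λ x → suc x % 2) (*-comm 2 m)) ([m+kn]%n≡m%n 1 m 2)

n≤1+f⇒n/2≤f : ∀ n f → n ≤ suc f → n / 2 ≤ f
n≤1+f⇒n/2≤f zero    f _   = z≤n
n≤1+f⇒n/2≤f (suc n) f n≤ = s≤s⁻¹ (<-≤-trans (m/n<m (suc n) 2 (s≤s (s≤s z≤n))) n≤)

n<2^n : ∀ n → n < 2 ^ n
n<2^n zero    = z<s
n<2^n (suc n) = ≤-<-trans (n<2^n n) (^-monoʳ-< 2 (s≤s (s≤s z≤n)) (n<1+n n))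

onesFuel-zero : ∀ f → onesFuel f 0 ≡ 0
onesFuel-zero zero    = refl
onesFuel-zero (suc f) = onesFuel-zero f

onesFuel-irrelevant : ∀ f f' n → n ≤ f → n ≤ f' → onesFuel f n ≡ onesFuel f' n
onesFuel-irrelevant zero    f'       zero _ _ = sym (onesFuel-zero f')
onesFuel-irrelevant (suc f) zero     zero _ _ = onesFuel-zero (suc f)
onesFuel-irrelevant (suc f) (suc f') n n≤ n≤' =
  cong (n % 2 +_) (onesFuel-irrelevant f f' (n / 2) (n≤1+f⇒n/2≤f n f n≤) (n≤1+f⇒n/2≤f n f' n≤'))

digitSum-unfold : ∀ n → digitSum n ≡ n % 2 + digitSum (n / 2)
digitSum-unfold zero    = refl
digitSum-unfold (suc n) = cong (suc n % 2 +_)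
  (onesFuel-irrelevant n (suc n / 2) (suc n / 2) (n≤1+f⇒n/2≤f (suc n) n ≤-refl) ≤-refl)

digitSum-double : ∀ m → digitSum (2 * m) ≡ digitSum m
digitSum-double m = trans (digitSum-unfold (2 * m))
  (cong₂ _+_ (2*m%2≡0 m) (cong digitSum (2*m/2≡m m)))

digitSum-suc-double : ∀ m → digitSum (suc (2 * m)) ≡ suc (digitSum m)
digitSum-suc-double m = trans (digitSum-unfold (suc (2 * m)))
  (cong₂ _+_ ([1+2*m]%2≡1 m) (cong digitSum ([1+2*m]/2≡m m)))

digitSum-2^ : ∀ i → digitSum (2 ^ i) ≡ 1
digitSum-2^ zero    = refl
digitSum-2^ (suc i) = trans (digitSum-double (2 ^ i)) (digitSum-2^ i)

-- If a + b = 2^j − 1 then b is the bitwise complement of a in j bits.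
digitSum-complement : ∀ j a b → suc (a + b) ≡ 2 ^ j → digitSum a + digitSum b ≡ j
digitSum-complement zero    zero    zero     _ = refl
digitSum-complement zero    zero    (suc b) ()
digitSum-complement zero    (suc a) b       ()
digitSum-complement (suc j) a b a+b+1≡ with parityView a | parityView b
... | even q | even r = contradiction (trans (sym a+b+1≡) (cong suc (sym (*-distribˡ-+ 2 q r))))
                                      (even≢odd (2 ^ j) (q + r))
... | odd q  | odd r  = contradiction (trans (sym a+b+1≡) (odd+odd+1 q r)) (even≢odd (2 ^ j) (suc (q + r)))
  where
  odd+odd+1 : ∀ q r → suc (suc (2 * q) + suc (2 * r)) ≡ suc (2 * suc (q + r))
  odd+odd+1 = solve-∀
... | even q | odd r  = begin
  digitSum (2 * q) + digitSum (suc (2 * r)) ≡⟨ cong₂ _+_ (digitSum-double q) (digitSum-suc-double r) ⟩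
  digitSum q + suc (digitSum r)             ≡⟨ +-suc (digitSum q) (digitSum r) ⟩
  suc (digitSum q + digitSum r)             ≡⟨ cong suc (digitSum-complement j q r q+r+1≡) ⟩
  suc j                                     ∎
  where
  open ≡-Reasoning
  even+odd+1 : ∀ q r → suc (2 * q + suc (2 * r)) ≡ 2 * suc (q + r)
  even+odd+1 = solve-∀
  q+r+1≡ : suc (q + r) ≡ 2 ^ j
  q+r+1≡ = *-cancelˡ-≡ _ _ 2 (trans (sym (even+odd+1 q r)) a+b+1≡)
... | odd q  | even r = begin
  digitSum (suc (2 * q)) + digitSum (2 * r) ≡⟨ cong₂ _+_ (digitSum-suc-double q) (digitSum-double r) ⟩
  suc (digitSum q + digitSum r)             ≡⟨ cong suc (digitSum-complement j q r q+r+1≡) ⟩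
  suc j                                     ∎
  where
  open ≡-Reasoning
  odd+even+1 : ∀ q r → suc (suc (2 * q) + 2 * r) ≡ 2 * suc (q + r)
  odd+even+1 = solve-∀
  q+r+1≡ : suc (q + r) ≡ 2 ^ j
  q+r+1≡ = *-cancelˡ-≡ _ _ 2 (trans (sym (odd+even+1 q r)) a+b+1≡)

isEvenᵇ-suc : ∀ n → isEvenᵇ (suc n) ≡ not (isEvenᵇ n)
isEvenᵇ-suc zero          = refl
isEvenᵇ-suc (suc zero)    = refl
isEvenᵇ-suc (suc (suc n)) = isEvenᵇ-suc n

isEvenᵇ-double : ∀ t → isEvenᵇ (2 * t) ≡ true
isEvenᵇ-double zero    = refl
isEvenᵇ-double (suc t) = trans (cong isEvenᵇ (*-suc 2 t)) (isEvenᵇ-double t)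

isEvenᵇ-+ : ∀ m n → isEvenᵇ (m + n) ≡ not (isEvenᵇ m xor isEvenᵇ n)
isEvenᵇ-+ zero    n = sym (not-involutive (isEvenᵇ n))
isEvenᵇ-+ (suc m) n = begin
  isEvenᵇ (suc (m + n))                       ≡⟨ isEvenᵇ-suc (m + n) ⟩
  not (isEvenᵇ (m + n))                       ≡⟨ cong not (isEvenᵇ-+ m n) ⟩
  not (not (isEvenᵇ m xor isEvenᵇ n))         ≡⟨ cong not (not-distribˡ-xor (isEvenᵇ m) (isEvenᵇ n)) ⟩
  not (not (isEvenᵇ m) xor isEvenᵇ n)         ≡⟨ cong (λ x → not (x xor isEvenᵇ n)) (sym (isEvenᵇ-suc m)) ⟩
  not (isEvenᵇ (suc m) xor isEvenᵇ n)         ∎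
  where open ≡-Reasoning

A₀-double : ∀ m → A₀ (2 * m) ≡ A₀ m
A₀-double m = cong isEvenᵇ (digitSum-double m)

A₀-suc-double : ∀ m → A₀ (suc (2 * m)) ≡ not (A₀ m)
A₀-suc-double m = trans (cong isEvenᵇ (digitSum-suc-double m)) (isEvenᵇ-suc (digitSum m))

A₀-2^ : ∀ i → A₀ (2 ^ i) ≡ false
A₀-2^ i = cong isEvenᵇ (digitSum-2^ i)

A₀-complement : ∀ t a b → suc (a + b) ≡ 2 ^ suc (2 * t) → A₀ b ≡ not (A₀ a)
A₀-complement t a b a+b+1≡ = not-xor-false (A₀ a) (A₀ b) (begin
  not (A₀ a xor A₀ b)                  ≡⟨ isEvenᵇ-+ (digitSum a) (digitSum b) ⟨
  isEvenᵇ (digitSum a + digitSum b)    ≡⟨ cong isEvenᵇ (digitSum-complement (suc (2 * t)) a b a+b+1≡) ⟩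
  isEvenᵇ (suc (2 * t))                ≡⟨ isEvenᵇ-suc (2 * t) ⟩
  not (isEvenᵇ (2 * t))                ≡⟨ cong not (isEvenᵇ-double t) ⟩
  false                                ∎)
  where
  open ≡-Reasoning
  not-xor-false : ∀ x y → not (x xor y) ≡ false → y ≡ not x
  not-xor-false true  false _ = refl
  not-xor-false false true  _ = refl
  not-xor-false true  true  ()
  not-xor-false false false ()

prefixFuel : ℕ → ℕ → ℕ → Bool
prefixFuel c zero    a = false
prefixFuel c (suc f) a with <-cmp a c
... | tri< _ _ _ = false
... | tri≈ _ _ _ = true
... | tri> _ _ _ = prefixFuel c f (a / 2)

-- hasPrefix c a holds iff c = ⌊a / 2^i⌋ for some i.
hasPrefix : ℕ → Subset
hasPrefix c a = prefixFuel c a a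

prefixFuel-below : ∀ {c a} f → a < c → prefixFuel c f a ≡ false
prefixFuel-below zero    a<c = refl
prefixFuel-below {c} {a} (suc f) a<c with <-cmp a c
... | tri< _ _   _   = refl
... | tri≈ _ a≡c _   = contradiction a≡c (<⇒≢ a<c)
... | tri> _ _   c<a = contradiction c<a (<⇒≯ a<c)

prefixFuel-irrelevant : ∀ {c} → 0 < c → ∀ f f' a → a ≤ f → a ≤ f' →
                        prefixFuel c f a ≡ prefixFuel c f' a
prefixFuel-irrelevant 0<c zero    f'       zero _ _ = sym (prefixFuel-below f' 0<c)
prefixFuel-irrelevant 0<c (suc f) zero     zero _ _ = prefixFuel-below (suc f) 0<c
prefixFuel-irrelevant {c} 0<c (suc f) (suc f') a a≤ a≤' with <-cmp a c
... | tri< _ _ _ = refl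
... | tri≈ _ _ _ = refl
... | tri> _ _ _ = prefixFuel-irrelevant 0<c f f' (a / 2) (n≤1+f⇒n/2≤f a f a≤) (n≤1+f⇒n/2≤f a f' a≤')

hasPrefix-below : ∀ {c a} → a < c → hasPrefix c a ≡ false
hasPrefix-below {a = a} = prefixFuel-below a

hasPrefix-self : ∀ {c} → 0 < c → hasPrefix c c ≡ true
hasPrefix-self {suc c} _ with <-cmp (suc c) (suc c)
... | tri< c<c _ _ = contradiction c<c (<-irrefl refl)
... | tri≈ _ _ _   = refl
... | tri> _ _ c>c = contradiction c>c (<-irrefl refl)

hasPrefix-above : ∀ {c a} → 0 < c → c < a → hasPrefix c a ≡ hasPrefix c (a / 2)
hasPrefix-above {c} {suc a} 0<c c<a with <-cmp (suc a) c
... | tri< _ _ c≮a = contradiction c<a c≮a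
... | tri≈ _ _ c≮a = contradiction c<a c≮a
... | tri> _ _ _   =
  prefixFuel-irrelevant 0<c a (suc a / 2) (suc a / 2) (n≤1+f⇒n/2≤f (suc a) a ≤-refl) ≤-refl

hasPrefix-double : ∀ {c} m → 0 < c → c < 2 * m → hasPrefix c (2 * m) ≡ hasPrefix c m
hasPrefix-double m 0<c c<2m = trans (hasPrefix-above 0<c c<2m) (cong (hasPrefix _) (2*m/2≡m m))

hasPrefix-suc-double : ∀ {c} m → 0 < c → c ≤ 2 * m → hasPrefix c (suc (2 * m)) ≡ hasPrefix c m
hasPrefix-suc-double m 0<c c≤2m = trans (hasPrefix-above 0<c (s≤s c≤2m)) (cong (hasPrefix _) ([1+2*m]/2≡m m))

∑< : ℕ → (ℕ → ℕ) → ℕ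
∑< zero    f = 0
∑< (suc n) f = f n + ∑< n f

syntax ∑< n (λ a → e) = ∑[ a < n ] e

⟦_⟧ : Bool → ℕ
⟦ true  ⟧ = 1
⟦ false ⟧ = 0

count : Subset → ℕ → ℕ
count S n = ∑[ a < n ] ⟦ S a ⟧

∑-cong : ∀ n {f h : ℕ → ℕ} → (∀ a → a < n → f a ≡ h a) → ∑< n f ≡ ∑< n h
∑-cong zero    _  = refl
∑-cong (suc n) eq = cong₂ _+_ (eq n ≤-refl) (∑-cong n (λ a a<n → eq a (m<n⇒m<1+n a<n)))

∑-mono : ∀ n {f h : ℕ → ℕ} → (∀ a → a < n → f a ≤ h a) → ∑< n f ≤ ∑< n h
∑-mono zero    _  = z≤n
∑-mono (suc n) le = +-mono-≤ (le n ≤-refl) (∑-mono n (λ a a<n → le a (m<n⇒m<1+n a<n)))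

∑-+ : ∀ n (f h : ℕ → ℕ) → ∑[ a < n ] (f a + h a) ≡ ∑< n f + ∑< n h
∑-+ zero    f h = refl
∑-+ (suc n) f h = trans (cong (f n + h n +_) (∑-+ n f h)) (interchange (f n) (h n) (∑< n f) (∑< n h))
  where
  interchange : ∀ w x y z → w + x + (y + z) ≡ w + y + (x + z)
  interchange = solve-∀

∑-one : ∀ n → ∑[ a < n ] 1 ≡ n
∑-one zero    = refl
∑-one (suc n) = cong suc (∑-one n)

∑-double : ∀ N (f : ℕ → ℕ) → ∑< (2 * N) f ≡ ∑[ m < N ] (f (2 * m) + f (suc (2 * m)))
∑-double zero    f = refl
∑-double (suc N) f = begin
  ∑< (2 * suc N) f
    ≡⟨ cong (λ x → ∑< x f) (*-suc 2 N) ⟩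
  f (suc (2 * N)) + (f (2 * N) + ∑< (2 * N) f)
    ≡⟨ +-assoc (f (suc (2 * N))) _ _ ⟨
  f (suc (2 * N)) + f (2 * N) + ∑< (2 * N) f
    ≡⟨ cong₂ _+_ (+-comm (f (suc (2 * N))) _) (∑-double N f) ⟩
  f (2 * N) + f (suc (2 * N)) + ∑[ m < N ] (f (2 * m) + f (suc (2 * m)))
    ∎
  where open ≡-Reasoning

∑-vanishing-from : ∀ {B N} {f : ℕ → ℕ} → B ≤ N → (∀ a → B ≤ a → a < N → f a ≡ 0) →
                   ∑< N f ≡ ∑< B f
∑-vanishing-from {B} {N} {f} B≤N zero-above =
  subst (λ x → ∑< x f ≡ ∑< B f) (m∸n+n≡m B≤N) (go (N ∸ B) (≤-reflexive (m∸n+n≡m B≤N)))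
  where
  go : ∀ d → d + B ≤ N → ∑< (d + B) f ≡ ∑< B f
  go zero    _ = refl
  go (suc d) le = trans (cong (_+ ∑< (d + B) f) (zero-above (d + B) (m≤n+m B d) le)) (go d (<⇒≤ le))

∑-agree-from : ∀ {B N} {f h : ℕ → ℕ} → B ≤ N → ∑< B f ≡ ∑< B h → (∀ a → B ≤ a → f a ≡ h a) →
               ∑< N f ≡ ∑< N h
∑-agree-from {B} {N} {f} {h} B≤N below above =
  subst (λ x → ∑< x f ≡ ∑< x h) (m∸n+n≡m B≤N) (go (N ∸ B))
  where
  go : ∀ d → ∑< (d + B) f ≡ ∑< (d + B) h
  go zero    = below
  go (suc d) = cong₂ _+_ (above (d + B) (m≤n+m B d)) (go d)

∑-shift : ∀ n (f : ℕ → ℕ) → ∑< (suc n) f ≡ ∑< n (f ∘ suc) + f 0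
∑-shift zero    f = +-identityʳ (f 0)
∑-shift (suc n) f = trans (cong (f (suc n) +_) (∑-shift n f)) (sym (+-assoc (f (suc n)) _ _))

∑-agree-except : ∀ {f h : ℕ → ℕ} x N → 0 < x → x < N → f 0 + f x ≡ h 0 + h x →
                 (∀ a → 0 < a → a ≢ x → f a ≡ h a) → ∑< N f ≡ ∑< N h
∑-agree-except {f} {h} (suc x) N _ x<N ends others =
  ∑-agree-from x<N up-to-x (λ a x<a → others a (<-trans z<s x<a) (>⇒≢ x<a))
  where
  open ≡-Reasoning
  split : ∀ (g : ℕ → ℕ) → ∑< (suc (suc x)) g ≡ g 0 + g (suc x) + ∑< x (g ∘ suc)
  split g = begin
    g (suc x) + ∑< (suc x) g          ≡⟨ cong (g (suc x) +_) (∑-shift x g) ⟩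
    g (suc x) + (∑< x (g ∘ suc) + g 0) ≡⟨ rearrange (g (suc x)) (∑< x (g ∘ suc)) (g 0) ⟩
    g 0 + g (suc x) + ∑< x (g ∘ suc)   ∎
    where
    rearrange : ∀ u v w → u + (v + w) ≡ w + u + v
    rearrange = solve-∀
  up-to-x : ∑< (suc (suc x)) f ≡ ∑< (suc (suc x)) h
  up-to-x = begin
    ∑< (suc (suc x)) f                ≡⟨ split f ⟩
    f 0 + f (suc x) + ∑< x (f ∘ suc)  ≡⟨ cong₂ _+_ ends (∑-cong x (λ a a<x → others (suc a) z<s (<⇒≢ (s<s a<x)))) ⟩
    h 0 + h (suc x) + ∑< x (h ∘ suc)  ≡⟨ split h ⟨
    ∑< (suc (suc x)) h                ∎

∑-reversed-prefix : ∀ (h : ℕ → ℕ) n A → A ≤ suc n →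
                    ∑[ a < A ] h (n ∸ a) + ∑< (suc n ∸ A) h ≡ ∑< (suc n) h
∑-reversed-prefix h n zero    _      = refl
∑-reversed-prefix h n (suc A) A<1+n = begin
  h (n ∸ A) + R + ∑< (n ∸ A) h      ≡⟨ rearrange (h (n ∸ A)) R (∑< (n ∸ A) h) ⟩
  R + ∑< (suc (n ∸ A)) h            ≡⟨ cong (λ x → R + ∑< x h) (+-∸-assoc 1 (s≤s⁻¹ A<1+n)) ⟨
  R + ∑< (suc n ∸ A) h              ≡⟨ ∑-reversed-prefix h n A (m≤n⇒m≤1+n (s≤s⁻¹ A<1+n)) ⟩
  ∑< (suc n) h                      ∎
  where
  open ≡-Reasoning
  R = ∑[ a < A ] h (n ∸ a)
  rearrange : ∀ x y z → x + y + z ≡ y + (x + z)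
  rearrange = solve-∀

∑-lowerHalf : ∀ n H (u : ℕ → ℕ) → n ≤ 2 * H → 2 * H ≤ suc n →
              ∑[ a < suc n ] (if a + a <ᵇ n then u a else 0) ≡ ∑< H u
∑-lowerHalf n H u n≤2H 2H≤1+n =
  trans (∑-vanishing-from (≤-trans (m≤n*m H 2) 2H≤1+n) (λ a H≤a _ → upper a H≤a)) (∑-cong H lower)
  where
  f : ℕ → ℕ
  f a = if a + a <ᵇ n then u a else 0
  lower : ∀ a → a < H → f a ≡ u a
  lower a a<H with a + a <ᵇ n | <ᵇ-reflects-< (a + a) n
  ... | true  | _          = refl
  ... | false | ofⁿ a+a≮n = contradiction (s≤s⁻¹ (begin
    suc (suc (a + a)) ≡⟨ double-suc a ⟩
    2 * suc a         ≤⟨ *-monoʳ-≤ 2 a<H ⟩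
    2 * H             ≤⟨ 2H≤1+n ⟩
    suc n             ∎)) a+a≮n
    where
    open ≤-Reasoning
    double-suc : ∀ a → suc (suc (a + a)) ≡ 2 * suc a
    double-suc = solve-∀
  upper : ∀ a → H ≤ a → f a ≡ 0
  upper a H≤a with a + a <ᵇ n | <ᵇ-reflects-< (a + a) n
  ... | false | _          = refl
  ... | true  | ofʸ a+a<n = contradiction a+a<n (≤⇒≯ (begin
    n       ≤⟨ n≤2H ⟩
    2 * H   ≤⟨ *-monoʳ-≤ 2 H≤a ⟩
    2 * a   ≡⟨ 2*m≡m+m a ⟩
    a + a   ∎))
    where open ≤-Reasoning

-- The guard a + a < n says a < n ∸ a: one term per decomposition n = a + b with a < b.
∑pairs : ℕ → (ℕ → ℕ → ℕ) → ℕ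
∑pairs n f = ∑[ a < suc n ] (if a + a <ᵇ n then f a (n ∸ a) else 0)

∑pairs-cong : ∀ n {f h : ℕ → ℕ → ℕ} → (∀ a b → f a b ≡ h a b) → ∑pairs n f ≡ ∑pairs n h
∑pairs-cong n eq = ∑-cong (suc n) (λ a _ → cong (λ x → if a + a <ᵇ n then x else 0) (eq a (n ∸ a)))

∑pairs-mono : ∀ n {f h : ℕ → ℕ → ℕ} → (∀ a → a ≤ n → f a (n ∸ a) ≤ h a (n ∸ a)) →
              ∑pairs n f ≤ ∑pairs n h
∑pairs-mono n {f} {h} le = ∑-mono (suc n) term
  where
  term : ∀ a → a < suc n →
         (if a + a <ᵇ n then f a (n ∸ a) else 0) ≤ (if a + a <ᵇ n then h a (n ∸ a) else 0)
  term a a<1+n with a + a <ᵇ n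
  ... | true  = le a (s≤s⁻¹ a<1+n)
  ... | false = z≤n

∑pairs-+ : ∀ n (f h : ℕ → ℕ → ℕ) → ∑pairs n (λ a b → f a b + h a b) ≡ ∑pairs n f + ∑pairs n h
∑pairs-+ n f h = trans (∑-cong (suc n) (λ a _ → if-+ (a + a <ᵇ n)))
  (∑-+ (suc n) (λ a → if a + a <ᵇ n then f a (n ∸ a) else 0)
               (λ a → if a + a <ᵇ n then h a (n ∸ a) else 0))
  where
  if-+ : ∀ {x y} b → (if b then x + y else 0) ≡ (if b then x else 0) + (if b then y else 0)
  if-+ true  = refl
  if-+ false = refl

∑pairs-one : ∀ n H → n ≤ 2 * H → 2 * H ≤ suc n → ∑pairs n (λ _ _ → 1) ≡ H
∑pairs-one n H n≤2H 2H≤1+n = trans (∑-lowerHalf n H (λ _ → 1) n≤2H 2H≤1+n) (∑-one H)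

∑pairs-odd : ∀ n H (h : ℕ → ℕ) → suc n ≡ 2 * H → ∑pairs n (λ a b → h a + h b) ≡ ∑< (suc n) h
∑pairs-odd n H h 1+n≡2H = begin
  ∑pairs n (λ a b → h a + h b)         ≡⟨ ∑-lowerHalf n H _ n≤2H (≤-reflexive (sym 1+n≡2H)) ⟩
  ∑[ a < H ] (h a + h (n ∸ a))         ≡⟨ ∑-+ H h _ ⟩
  ∑< H h + R                           ≡⟨ +-comm (∑< H h) R ⟩
  R + ∑< H h                           ≡⟨ cong (λ x → R + ∑< x h) 1+n∸H≡H ⟨
  R + ∑< (suc n ∸ H) h                 ≡⟨ ∑-reversed-prefix h n H H≤1+n ⟩
  ∑< (suc n) h                         ∎
  where
  open ≡-Reasoning
  R = ∑[ a < H ] h (n ∸ a)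
  n≤2H : n ≤ 2 * H
  n≤2H = ≤-trans (n≤1+n n) (≤-reflexive 1+n≡2H)
  H≤1+n : H ≤ suc n
  H≤1+n = ≤-trans (m≤n*m H 2) (≤-reflexive (sym 1+n≡2H))
  1+n∸H≡H : suc n ∸ H ≡ H
  1+n∸H≡H = trans (cong (_∸ H) (trans 1+n≡2H (2*m≡m+m H))) (m+n∸m≡n H H)

∑pairs-even : ∀ m (h : ℕ → ℕ) → ∑pairs (2 * m) (λ a b → h a + h b) + h m ≡ ∑< (suc (2 * m)) h
∑pairs-even m h = begin
  ∑pairs n (λ a b → h a + h b) + h m   ≡⟨ cong (_+ h m) (∑-lowerHalf n m _ ≤-refl (n≤1+n n)) ⟩
  ∑[ a < m ] (h a + h (n ∸ a)) + h m   ≡⟨ cong (_+ h m) (∑-+ m h _) ⟩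
  ∑< m h + R + h m                     ≡⟨ rearrange (∑< m h) R (h m) ⟩
  R + ∑< (suc m) h                     ≡⟨ cong (λ x → R + ∑< x h) 1+n∸m≡1+m ⟨
  R + ∑< (suc n ∸ m) h                 ≡⟨ ∑-reversed-prefix h n m (m≤n⇒m≤1+n m≤n) ⟩
  ∑< (suc n) h                         ∎
  where
  open ≡-Reasoning
  n = 2 * m
  R = ∑[ a < m ] h (n ∸ a)
  m≤n : m ≤ n
  m≤n = m≤n*m m 2
  1+n∸m≡1+m : suc n ∸ m ≡ suc m
  1+n∸m≡1+m = trans (+-∸-assoc 1 m≤n) (cong suc (trans (cong (_∸ m) (2*m≡m+m m)) (m+n∸m≡n m m)))
  rearrange : ∀ x y z → x + y + z ≡ y + (z + x)
  rearrange = solve-∀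

R₂-as-∑pairs : ∀ S n → R₂ S n ≡ ∑pairs n (λ a b → ⟦ S a ∧ S b ⟧)
R₂-as-∑pairs S n = go (suc n)
  where
  term : ∀ x y → (if x ∧ y then 1 else 0) ≡ (if y then ⟦ x ⟧ else 0)
  term true  y     = refl
  term false true  = refl
  term false false = refl
  go : ∀ A → countR S n A ≡ ∑[ a < A ] (if a + a <ᵇ n then ⟦ S a ∧ S (n ∸ a) ⟧ else 0)
  go zero    = refl
  go (suc A) = cong₂ _+_ (term (S A ∧ S (n ∸ A)) (A + A <ᵇ n)) (go A)

pair-balance : ∀ S a b → ⟦ S a ∧ S b ⟧ + 1 ≡ ⟦ complement S a ∧ complement S b ⟧ + (⟦ S a ⟧ + ⟦ S b ⟧)
pair-balance S a b with S a | S b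
... | true  | true  = refl
... | true  | false = refl
... | false | true  = refl
... | false | false = refl

R₂-balance : ∀ S n → R₂ S n + ∑pairs n (λ _ _ → 1)
                   ≡ R₂ (complement S) n + ∑pairs n (λ a b → ⟦ S a ⟧ + ⟦ S b ⟧)
R₂-balance S n = begin
  R₂ S n + ∑pairs n one
    ≡⟨ cong (_+ ∑pairs n one) (R₂-as-∑pairs S n) ⟩
  ∑pairs n both + ∑pairs n one
    ≡⟨ ∑pairs-+ n both one ⟨
  ∑pairs n (λ a b → both a b + 1)
    ≡⟨ ∑pairs-cong n (pair-balance S) ⟩
  ∑pairs n (λ a b → neither a b + members a b)
    ≡⟨ ∑pairs-+ n neither members ⟩
  ∑pairs n neither + ∑pairs n members
    ≡⟨ cong (_+ ∑pairs n members) (R₂-as-∑pairs (complement S) n) ⟨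
  R₂ (complement S) n + ∑pairs n members
    ∎
  where
  open ≡-Reasoning
  one both neither members : ℕ → ℕ → ℕ
  one _ _       = 1
  both a b      = ⟦ S a ∧ S b ⟧
  neither a b   = ⟦ complement S a ∧ complement S b ⟧
  members a b   = ⟦ S a ⟧ + ⟦ S b ⟧

R₂-complement-odd : ∀ S n H → suc n ≡ 2 * H → count S (suc n) ≡ H → R₂ S n ≡ R₂ (complement S) n
R₂-complement-odd S n H 1+n≡2H count≡H = +-cancelʳ-≡ H _ _ (begin
  R₂ S n + H                                                 ≡⟨ cong (R₂ S n +_) pairs ⟨
  R₂ S n + ∑pairs n (λ _ _ → 1)                              ≡⟨ R₂-balance S n ⟩
  R₂ (complement S) n + ∑pairs n (λ a b → ⟦ S a ⟧ + ⟦ S b ⟧) ≡⟨ cong (R₂ (complement S) n +_) members ⟩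
  R₂ (complement S) n + H                                    ∎)
  where
  open ≡-Reasoning
  pairs : ∑pairs n (λ _ _ → 1) ≡ H
  pairs = ∑pairs-one n H (≤-trans (n≤1+n n) (≤-reflexive 1+n≡2H)) (≤-reflexive (sym 1+n≡2H))
  members : ∑pairs n (λ a b → ⟦ S a ⟧ + ⟦ S b ⟧) ≡ H
  members = trans (∑pairs-odd n H (λ a → ⟦ S a ⟧) 1+n≡2H) count≡H

R₂-complement-even : ∀ S m → count S (suc (2 * m)) ≡ m + ⟦ S m ⟧ → R₂ S (2 * m) ≡ R₂ (complement S) (2 * m)
R₂-complement-even S m count≡ = +-cancelʳ-≡ m _ _ (begin
  R₂ S n + m                                                 ≡⟨ cong (R₂ S n +_) pairs ⟨
  R₂ S n + ∑pairs n (λ _ _ → 1)                              ≡⟨ R₂-balance S n ⟩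
  R₂ (complement S) n + ∑pairs n (λ a b → ⟦ S a ⟧ + ⟦ S b ⟧) ≡⟨ cong (R₂ (complement S) n +_) members ⟩
  R₂ (complement S) n + m                                    ∎)
  where
  open ≡-Reasoning
  n = 2 * m
  pairs : ∑pairs n (λ _ _ → 1) ≡ m
  pairs = ∑pairs-one n m ≤-refl (n≤1+n n)
  members : ∑pairs n (λ a b → ⟦ S a ⟧ + ⟦ S b ⟧) ≡ m
  members = +-cancelʳ-≡ ⟦ S m ⟧ _ _ (trans (∑pairs-even m (λ a → ⟦ S a ⟧)) count≡)

pair-bound : ∀ (S T : Subset) a b → (T a ≡ false → T b ≡ false → S b ≡ not (S a)) →
             ⟦ S a ∧ S b ⟧ + ⟦ complement S a ∧ complement S b ⟧ ≤ ⟦ T a ⟧ + ⟦ T b ⟧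
pair-bound S T a b outside-T with S a | S b | T a | T b | outside-T
... | true  | false | _     | _     | _ = z≤n
... | false | true  | _     | _     | _ = z≤n
... | true  | true  | true  | _     | _ = s≤s z≤n
... | true  | true  | false | true  | _ = s≤s z≤n
... | true  | true  | false | false | h = contradiction (h refl refl) λ ()
... | false | false | true  | _     | _ = s≤s z≤n
... | false | false | false | true  | _ = s≤s z≤n
... | false | false | false | false | h = contradiction (h refl refl) λ ()

R₂-sum-bound : ∀ S T n → (∀ a → a ≤ n → T a ≡ false → T (n ∸ a) ≡ false → S (n ∸ a) ≡ not (S a)) →
               R₂ S n + R₂ (complement S) n ≤ ∑pairs n (λ a b → ⟦ T a ⟧ + ⟦ T b ⟧)
R₂-sum-bound S T n outside-T = begin
  R₂ S n + R₂ (complement S) n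
    ≡⟨ cong₂ _+_ (R₂-as-∑pairs S n) (R₂-as-∑pairs (complement S) n) ⟩
  ∑pairs n both + ∑pairs n neither
    ≡⟨ ∑pairs-+ n both neither ⟨
  ∑pairs n (λ a b → both a b + neither a b)
    ≤⟨ ∑pairs-mono n {λ a b → both a b + neither a b} {λ a b → ⟦ T a ⟧ + ⟦ T b ⟧}
                     (λ a a≤n → pair-bound S T a (n ∸ a) (outside-T a a≤n)) ⟩
  ∑pairs n (λ a b → ⟦ T a ⟧ + ⟦ T b ⟧)
    ∎
  where
  open ≤-Reasoning
  both neither : ℕ → ℕ → ℕ
  both a b    = ⟦ S a ∧ S b ⟧
  neither a b = ⟦ complement S a ∧ complement S b ⟧

scaling-invariant : ∀ {X : Set} (f : ℕ → X) B → (∀ m → B ≤ m → f (2 * m) ≡ f m) →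
                    ∀ i {a} → B ≤ a → f (2 ^ i * a) ≡ f a
scaling-invariant f B double zero    {a} B≤a = cong f (*-identityˡ a)
scaling-invariant f B double (suc i) {a} B≤a = begin
  f (2 * 2 ^ i * a)   ≡⟨ cong f (*-assoc 2 (2 ^ i) a) ⟩
  f (2 * (2 ^ i * a)) ≡⟨ double (2 ^ i * a) (≤-trans B≤a (m≤n*m a (2 ^ i) {{m^n≢0 2 i}})) ⟩
  f (2 ^ i * a)       ≡⟨ scaling-invariant f B double i B≤a ⟩
  f a                 ∎
  where open ≡-Reasoning

m≤2^m*x : ∀ m {x} → 0 < x → m ≤ 2 ^ m * x
m≤2^m*x m {x} 0<x = begin
  m           ≤⟨ <⇒≤ (n<2^n m) ⟩
  2 ^ m       ≡⟨ *-identityʳ (2 ^ m) ⟨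
  2 ^ m * 1   ≤⟨ *-monoʳ-≤ (2 ^ m) 0<x ⟩
  2 ^ m * x   ∎
  where open ≤-Reasoning

module Construction (k : ℕ) where

  p c : ℕ
  p = 2 ^ k
  c = 2 * p

  0<p : 0 < p
  0<p = m^n>0 2 k

  p<c : p < c
  p<c = begin-strict
    p       ≡⟨ +-identityʳ p ⟨
    p + 0   <⟨ +-monoʳ-< p 0<p ⟩
    p + p   ≡⟨ 2*m≡m+m p ⟨
    c       ∎
    where open ≤-Reasoning

  0<c : 0 < c
  0<c = <-trans 0<p p<c

  1<c : 1 < c
  1<c = ≤-trans (s≤s 0<p) p<c

  Φ : Subset
  Φ zero    = true
  Φ (suc a) = hasPrefix c (suc a)

  D : Subset
  D a = Φ a xor A₀ a

  Φ-pos : ∀ {a} → 0 < a → Φ a ≡ hasPrefix c a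
  Φ-pos {suc a} _ = refl

  Φ-below : ∀ {a} → 0 < a → a < c → Φ a ≡ false
  Φ-below 0<a a<c = trans (Φ-pos 0<a) (hasPrefix-below a<c)

  Φ-c : Φ c ≡ true
  Φ-c = trans (Φ-pos 0<c) (hasPrefix-self 0<c)

  Φ-suc-double : ∀ {m} → 0 < m → Φ (suc (2 * m)) ≡ Φ m
  Φ-suc-double {m} 0<m with m <? p
  ... | yes m<p = trans (Φ-below z<s 1+2m<c) (sym (Φ-below 0<m (<-trans m<p p<c)))
    where
    1+2m<c : suc (2 * m) < c
    1+2m<c = subst (_≤ c) (*-suc 2 m) (*-monoʳ-≤ 2 m<p)
  ... | no  m≮p = begin
    Φ (suc (2 * m))         ≡⟨ hasPrefix-suc-double m 0<c (*-monoʳ-≤ 2 (≮⇒≥ m≮p)) ⟩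
    hasPrefix c m           ≡⟨ Φ-pos 0<m ⟨
    Φ m                     ∎
    where open ≡-Reasoning

  Φ-double : ∀ {m} → 0 < m → m ≢ p → Φ (2 * m) ≡ Φ m
  Φ-double {m} 0<m m≢p with <-cmp m p
  ... | tri< m<p _ _ =
    trans (Φ-below (*-monoʳ-< 2 0<m) (*-monoʳ-< 2 m<p)) (sym (Φ-below 0<m (<-trans m<p p<c)))
  ... | tri≈ _ m≡p _ = contradiction m≡p m≢p
  ... | tri> _ _ p<m = begin
    Φ (2 * m)               ≡⟨ Φ-pos (*-monoʳ-< 2 0<m) ⟩
    hasPrefix c (2 * m)     ≡⟨ hasPrefix-double m 0<c (*-monoʳ-< 2 p<m) ⟩
    hasPrefix c m           ≡⟨ Φ-pos 0<m ⟨
    Φ m                     ∎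
    where open ≡-Reasoning

  Φ-1 : Φ 1 ≡ false
  Φ-1 = Φ-below z<s 1<c

  Φ-suc-c : Φ (suc c) ≡ false
  Φ-suc-c = trans (Φ-suc-double 0<p) (Φ-below 0<p p<c)

  A₀-suc-c : A₀ (suc c) ≡ true
  A₀-suc-c = trans (A₀-suc-double p) (cong not (A₀-2^ k))

  D-c : D c ≡ true
  D-c = cong₂ _xor_ Φ-c (A₀-2^ (suc k))

  D-suc-c : D (suc c) ≡ true
  D-suc-c = cong₂ _xor_ Φ-suc-c A₀-suc-c

  D-1 : D 1 ≡ false
  D-1 = cong (_xor A₀ 1) Φ-1

  D-pair : ∀ m → 0 < m → m ≢ p → ⟦ D (2 * m) ⟧ + ⟦ D (suc (2 * m)) ⟧ ≡ 1
  D-pair m 0<m m≢p = begin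
    ⟦ D (2 * m) ⟧ + ⟦ D (suc (2 * m)) ⟧      ≡⟨ cong₂ (λ u v → ⟦ u ⟧ + ⟦ v ⟧)
                                                  (cong₂ _xor_ (Φ-double 0<m m≢p) (A₀-double m))
                                                  (cong₂ _xor_ (Φ-suc-double 0<m) (A₀-suc-double m)) ⟩
    ⟦ Φ m xor A₀ m ⟧ + ⟦ Φ m xor not (A₀ m) ⟧ ≡⟨ exactly-one (Φ m) (A₀ m) ⟩
    1                                         ∎
    where
    open ≡-Reasoning
    exactly-one : ∀ x y → ⟦ x xor y ⟧ + ⟦ x xor not y ⟧ ≡ 1
    exactly-one true  true  = refl
    exactly-one true  false = refl
    exactly-one false true  = refl
    exactly-one false false = refl

  D-double : ∀ m → suc p ≤ m → D (2 * m) ≡ D m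
  D-double m p<m = cong₂ _xor_ (Φ-double (<-trans 0<p p<m) (>⇒≢ p<m)) (A₀-double m)

  count-D-double : ∀ N → p < N → count D (2 * N) ≡ N
  count-D-double N p<N = begin
    count D (2 * N)                                 ≡⟨ ∑-double N (λ a → ⟦ D a ⟧) ⟩
    ∑[ m < N ] (⟦ D (2 * m) ⟧ + ⟦ D (suc (2 * m)) ⟧) ≡⟨ ∑-agree-except p N 0<p p<N ends D-pair ⟩
    ∑[ m < N ] 1                                    ≡⟨ ∑-one N ⟩
    N                                               ∎
    where
    open ≡-Reasoning
    ends : ⟦ D 0 ⟧ + ⟦ D 1 ⟧ + (⟦ D c ⟧ + ⟦ D (suc c) ⟧) ≡ 2
    ends rewrite D-1 | D-c | D-suc-c = refl

  2M∸1≡1+c : 2 * M k ∸ 1 ≡ suc c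
  2M∸1≡1+c = cong (_∸ 1) (double-+1 p)
    where
    double-+1 : ∀ p → 2 * (p + 1) ≡ suc (suc (2 * p))
    double-+1 = solve-∀

  R₂-D-complement : ∀ n → 2 * M k ∸ 1 ≤ n → R₂ D n ≡ R₂ (complement D) n
  R₂-D-complement n 2M∸1≤n with parityView n
  ... | even m = R₂-complement-even D m (begin
    ⟦ D (2 * m) ⟧ + count D (2 * m) ≡⟨ cong₂ _+_ (cong ⟦_⟧ (D-double m p<m)) (count-D-double m p<m) ⟩
    ⟦ D m ⟧ + m                     ≡⟨ +-comm ⟦ D m ⟧ m ⟩
    m + ⟦ D m ⟧                     ∎)
    where
    open ≡-Reasoning
    p<m : p < m
    p<m = *-cancelˡ-< 2 p m (subst (_≤ 2 * m) 2M∸1≡1+c 2M∸1≤n)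
  ... | odd m = R₂-complement-odd D (suc (2 * m)) (suc m) (sym (*-suc 2 m))
    (trans (cong (count D) (sym (*-suc 2 m))) (count-D-double (suc m) (s≤s p≤m)))
    where
    p≤m : p ≤ m
    p≤m = *-cancelˡ-≤ 2 (s≤s⁻¹ (subst (_≤ suc (2 * m)) 2M∸1≡1+c 2M∸1≤n))

  D-scaled : ∀ i {a} → suc p ≤ a → D (2 ^ i * a) ≡ D a
  D-scaled = scaling-invariant D (suc p) D-double

  A₀-scaled : ∀ i a → A₀ (2 ^ i * a) ≡ A₀ a
  A₀-scaled i a = scaling-invariant A₀ 0 (λ m _ → A₀-double m) i z≤n

  unbounded-D∩A₀ : ∀ m → Σ ℕ λ a → m ≤ a × a ∈ D × a ∈ A₀
  unbounded-D∩A₀ m = 2 ^ m * suc c , m≤2^m*x m z<s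
                   , trans (D-scaled m (<-trans p<c (n<1+n c))) D-suc-c
                   , trans (A₀-scaled m (suc c)) A₀-suc-c

  unbounded-D∩B₀ : ∀ m → Σ ℕ λ a → m ≤ a × a ∈ D × a ∈ B₀
  unbounded-D∩B₀ m = 2 ^ m * c , m≤2^m*x m 0<c
                   , trans (D-scaled m p<c) D-c
                   , cong (λ x → if x then false else true) (trans (A₀-scaled m c) (A₀-2^ (suc k)))

  count-Φ-double : ∀ N → p < N → count Φ (2 * N) ≡ count Φ N + count Φ N
  count-Φ-double N p<N = begin
    count Φ (2 * N)                                 ≡⟨ ∑-double N (λ a → ⟦ Φ a ⟧) ⟩
    ∑[ m < N ] (⟦ Φ (2 * m) ⟧ + ⟦ Φ (suc (2 * m)) ⟧) ≡⟨ ∑-agree-except p N 0<p p<N ends pair ⟩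
    ∑[ m < N ] (⟦ Φ m ⟧ + ⟦ Φ m ⟧)                   ≡⟨ ∑-+ N (λ a → ⟦ Φ a ⟧) (λ a → ⟦ Φ a ⟧) ⟩
    count Φ N + count Φ N                           ∎
    where
    open ≡-Reasoning
    ends : ⟦ Φ 0 ⟧ + ⟦ Φ 1 ⟧ + (⟦ Φ c ⟧ + ⟦ Φ (suc c) ⟧)
         ≡ ⟦ Φ 0 ⟧ + ⟦ Φ 0 ⟧ + (⟦ Φ p ⟧ + ⟦ Φ p ⟧)
    ends rewrite Φ-1 | Φ-c | Φ-suc-c | Φ-below 0<p p<c = refl
    pair : ∀ m → 0 < m → m ≢ p → ⟦ Φ (2 * m) ⟧ + ⟦ Φ (suc (2 * m)) ⟧ ≡ ⟦ Φ m ⟧ + ⟦ Φ m ⟧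
    pair m 0<m m≢p = cong₂ (λ u v → ⟦ u ⟧ + ⟦ v ⟧) (Φ-double 0<m m≢p) (Φ-suc-double 0<m)

  count-Φ-c : count Φ c ≡ 1
  count-Φ-c = ∑-vanishing-from 0<c (λ a 1≤a a<c → cong ⟦_⟧ (Φ-below 1≤a a<c))

  count-Φ-2^ : ∀ j → suc k ≤ j → c * count Φ (2 ^ j) ≡ 2 ^ j
  count-Φ-2^ j k<j = subst (λ x → c * count Φ (2 ^ x) ≡ 2 ^ x) (m∸n+n≡m k<j) (go (j ∸ suc k))
    where
    go : ∀ d → c * count Φ (2 ^ (d + suc k)) ≡ 2 ^ (d + suc k)
    go zero    = trans (cong (c *_) count-Φ-c) (*-identityʳ c)
    go (suc d) = begin
      c * count Φ (2 * X)               ≡⟨ cong (c *_) (count-Φ-double X p<X) ⟩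
      c * (count Φ X + count Φ X)       ≡⟨ *-distribˡ-+ c (count Φ X) (count Φ X) ⟩
      c * count Φ X + c * count Φ X     ≡⟨ cong₂ _+_ (go d) (go d) ⟩
      X + X                             ≡⟨ 2*m≡m+m X ⟨
      2 * X                             ∎
      where
      open ≡-Reasoning
      X = 2 ^ (d + suc k)
      p<X : p < X
      p<X = <-≤-trans p<c (^-monoʳ-≤ 2 (m≤n+m (suc k) d))

  few-representations : ∀ m₀ → Σ ℕ λ n → m₀ ≤ n × 4 * (M k ∸ 1) * R₂ D n ≤ n + 1
  few-representations m₀ = n , m₀≤n , bound
    where
    t j n : ℕ
    t = suc (k + m₀)
    j = suc (2 * t)
    n = 2 ^ j ∸ 1

    1+n≡2^j : suc n ≡ 2 ^ j
    1+n≡2^j = m+[n∸m]≡n (m^n>0 2 j)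

    t≤j : t ≤ j
    t≤j = m≤n⇒m≤1+n (m≤n*m t 2)

    m₀≤n : m₀ ≤ n
    m₀≤n = s≤s⁻¹ (subst (m₀ <_) (sym 1+n≡2^j) (<-trans (<-≤-trans (s≤s (m≤n+m m₀ k)) t≤j) (n<2^n j)))

    2M∸1≤n : 2 * M k ∸ 1 ≤ n
    2M∸1≤n = subst (_≤ n) (sym 2M∸1≡1+c) (s≤s⁻¹ (begin
      suc (suc c)          ≤⟨ +-monoˡ-≤ c 1<c ⟩
      c + c                ≡⟨ 2*m≡m+m c ⟨
      2 ^ suc (suc k)      ≤⟨ ^-monoʳ-≤ 2 (s≤s (≤-trans (s≤s (m≤m+n k m₀)) (m≤n*m t 2))) ⟩
      2 ^ j                ≡⟨ 1+n≡2^j ⟨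
      suc n                ∎))
      where open ≤-Reasoning

    antipodal : ∀ a → a ≤ n → Φ a ≡ false → Φ (n ∸ a) ≡ false → D (n ∸ a) ≡ not (D a)
    antipodal a a≤n Φa Φn∸a = begin
      D (n ∸ a)         ≡⟨ cong (_xor A₀ (n ∸ a)) Φn∸a ⟩
      A₀ (n ∸ a)        ≡⟨ A₀-complement t a (n ∸ a) (trans (cong suc (m+[n∸m]≡n a≤n)) 1+n≡2^j) ⟩
      not (A₀ a)        ≡⟨ cong (λ x → not (x xor A₀ a)) Φa ⟨
      not (D a)         ∎
      where open ≡-Reasoning

    R = R₂ D n

    R+R≤ : R + R ≤ count Φ (2 ^ j)
    R+R≤ = begin
      R + R                                  ≡⟨ cong (R +_) (R₂-D-complement n 2M∸1≤n) ⟩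
      R + R₂ (complement D) n                ≤⟨ R₂-sum-bound D Φ n antipodal ⟩
      ∑pairs n (λ a b → ⟦ Φ a ⟧ + ⟦ Φ b ⟧)   ≡⟨ ∑pairs-odd n (2 ^ (2 * t)) (λ a → ⟦ Φ a ⟧) 1+n≡2^j ⟩
      count Φ (suc n)                        ≡⟨ cong (count Φ) 1+n≡2^j ⟩
      count Φ (2 ^ j)                        ∎
      where open ≤-Reasoning

    bound : 4 * (M k ∸ 1) * R ≤ n + 1
    bound = begin
      4 * (M k ∸ 1) * R       ≡⟨ cong (λ x → 4 * x * R) (m+n∸n≡m p 1) ⟩
      4 * p * R               ≡⟨ regroup p R ⟩
      c * (R + R)             ≤⟨ *-monoʳ-≤ c R+R≤ ⟩
      c * count Φ (2 ^ j)     ≡⟨ count-Φ-2^ j (≤-trans (s≤s (m≤m+n k m₀)) t≤j) ⟩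
      2 ^ j                   ≡⟨ 1+n≡2^j ⟨
      suc n                   ≡⟨ +-comm 1 n ⟩
      n + 1                   ∎
      where
      open ≤-Reasoning
      regroup : ∀ p R → 4 * p * R ≡ 2 * p * (R + R)
      regroup = solve-∀

corollary2 : (k : ℕ) → Σ Subset λ D →
      ((n : ℕ) → 2 * M k ∸ 1 ≤ n → R₂ D n ≡ R₂ (complement D) n)
    × ((m : ℕ) → Σ ℕ λ a → m ≤ a × a ∈ D × a ∈ A₀)
    × ((m : ℕ) → Σ ℕ λ a → m ≤ a × a ∈ D × a ∈ B₀)
    × ((m : ℕ) → Σ ℕ λ n → m ≤ n × 4 * (M k ∸ 1) * R₂ D n ≤ n + 1)
corollary2 k = D , R₂-D-complement , unbounded-D∩A₀ , unbounded-D∩B₀ , few-representations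
  where open Construction k
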